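{- Every irreducible sequent that is derivable in $\mathbf{G3iM^w}$ has a sensible strict proof in $\mathbf{G3iM^w}$.
   Context: Formulas are built from atoms, $\bot$, $\wedge,\vee,\to$ and $\Box$. $\mathbf{G3iM^w}$ is the sequent calculus on sequents $\Gamma\Rightarrow\phi$ ($\Gamma$ a finite multiset of formulas) with axioms $\Gamma,p\Rightarrow p$ ($p$ atom), $\Gamma,\bot\Rightarrow\phi$ and rules: $L\wedge$ (from $\Gamma,\phi,\psi\Rightarrow\theta$ infer $\Gamma,\phi\wedge\psi\Rightarrow\theta$), $R\wedge$ (from $\Gamma\Rightarrow\phi$, $\Gamma\Rightarrow\psi$ infer $\Gamma\Rightarrow\phi\wedge\psi$), $L\vee$ (from $\Gamma,\phi\Rightarrow\theta$, $\Gamma,\psi\Rightarrow\theta$ infer $\Gamma,\phi\vee\psi\Rightarrow\theta$), $R\vee$ (from $\Gamma\Rightarrow\phi_i$ infer $\Gamma\Rightarrow\phi_0\vee\phi_1$, $i=0,1$), $L{\to}$ (from $\Gamma,\phi\to\psi\Rightarrow\phi$ and $\Gamma,\psi\Rightarrow\theta$ infer $\Gamma,\phi\to\psi\Rightarrow\theta$; principal formula $\phi\to\psi$), $R{\to}$ (from $\Gamma,\phi\Rightarrow\psi$ infer $\Gamma\Rightarrow\phi\to\psi$), and the modal rule $M^{seq}_\Box$ (from $\phi\Rightarrow\psi$ infer $\Gamma,\Box\phi\Rightarrow\Box\psi$). A multiset is irreducible if none of its elements is a disjunction, a conjunction or $\bot$, and for no atom $p$ does it contain both $p$ and some formula $p\to\psi$.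 A sequent is irreducible if its antecedent is. A proof is sensible if its last inference does not have a principal formula in the antecedent of the form $p\to\psi$ with $p$ an atom. A proof is strict if, in case its last inference is an instance of $L{\to}$ with principal formula of the form $\Box\phi\to\psi$, the left premise of that inference is an axiom or the conclusion of an application of the modal rule. -}

module Defs where

open import Data.Nat using (ℕ)
open import Data.List using (List; []; _∷_)
open import Data.List.Membership.Propositional using (_∈_)
open import Data.List.Relation.Binary.Permutation.Propositional using (_↭_)
open import Data.Product using (_×_; Σ; ∃)
open import Data.Empty using (⊥)
open import Data.Unit using (⊤)
open import Data.Sum using (_⊎_)

infixr 6 _∧_
infixr 5 _∨_
infixr 4 _⇒_

data Fm : Set where
  atom : ℕ → Fm
  ⊥'   : Fm
  _∧_  : Fm → Fm → Fm
  _∨_  : Fm → Fm → Fm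
  _⇒_  : Fm → Fm → Fm
  □    : Fm → Fm

-- Antecedents are finite multisets, represented as lists; every rule
-- locates its principal formula up to permutation (_↭_), so the calculus
-- is insensitive to order, i.e. operates on multisets.
Ctx : Set
Ctx = List Fm

data Proof : Ctx → Fm → Set where
  ax   : ∀ {Γ p} → atom p ∈ Γ → Proof Γ (atom p)
  ⊥L   : ∀ {Γ φ} → ⊥' ∈ Γ → Proof Γ φ
  L∧   : ∀ {Γ Δ φ ψ θ} → Γ ↭ ((φ ∧ ψ) ∷ Δ) →
         Proof (φ ∷ ψ ∷ Δ) θ → Proof Γ θ
  R∧   : ∀ {Γ φ ψ} → Proof Γ φ → Proof Γ ψ → Proof Γ (φ ∧ ψ)
  L∨   : ∀ {Γ Δ φ ψ θ} → Γ ↭ ((φ ∨ ψ) ∷ Δ) →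
         Proof (φ ∷ Δ) θ → Proof (ψ ∷ Δ) θ → Proof Γ θ
  R∨₀  : ∀ {Γ φ ψ} → Proof Γ φ → Proof Γ (φ ∨ ψ)
  R∨₁  : ∀ {Γ φ ψ} → Proof Γ ψ → Proof Γ (φ ∨ ψ)
  -- left premise: Γ', φ→ψ ⇒ φ (principal formula kept); right: Γ', ψ ⇒ θ
  L⇒   : ∀ {Γ Δ φ ψ θ} → Γ ↭ ((φ ⇒ ψ) ∷ Δ) →
         Proof Γ φ → Proof (ψ ∷ Δ) θ → Proof Γ θ
  R⇒   : ∀ {Γ φ ψ} → Proof (φ ∷ Γ) ψ → Proof Γ (φ ⇒ ψ)
  M□   : ∀ {Γ Δ φ ψ} → Γ ↭ (□ φ ∷ Δ) →
         Proof (φ ∷ []) ψ → Proof Γ (□ ψ)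

Derivable : Ctx → Fm → Set
Derivable Γ φ = Proof Γ φ

NotDecomposable : Fm → Set
NotDecomposable (_ ∧ _) = ⊥
NotDecomposable (_ ∨ _) = ⊥
NotDecomposable ⊥'      = ⊥
NotDecomposable _       = ⊤

Irreducible : Ctx → Set
Irreducible Γ =
  (∀ {φ} → φ ∈ Γ → NotDecomposable φ) ×
  (∀ p ψ → atom p ∈ Γ → (atom p ⇒ ψ) ∈ Γ → ⊥)

IsAxiom : ∀ {Γ φ} → Proof Γ φ → Set
IsAxiom (ax _) = ⊤
IsAxiom (⊥L _) = ⊤
IsAxiom _      = ⊥

IsModal : ∀ {Γ φ} → Proof Γ φ → Set
IsModal (M□ _ _) = ⊤
IsModal _        = ⊥

Sensible : ∀ {Γ φ} → Proof Γ φ → Set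
Sensible (L⇒ {φ = atom _} _ _ _) = ⊥
Sensible _                         = ⊤

Strict : ∀ {Γ φ} → Proof Γ φ → Set
Strict (L⇒ {φ = □ _} _ l _) = IsAxiom l ⊎ IsModal l
Strict _                      = ⊤

-- Suppose the last inference of a proof of Γ ⇒ θ is L→ with principal formula
-- a → b, where a is an atom or a box. Its left premise Γ ⇒ a cannot be an axiom
-- (Γ would contain both p and p → b), a right rule, or a left rule for ∧, ∨, ⊥
-- (Γ is irreducible); so it ends in the modal rule, which makes the proof strict,
-- or in L→ with some principal formula e → f. In the latter case we move that
-- inner L→ to the root, taking as its new right premise the inversion
-- Γ', f ⇒ θ of the whole proof. If e is again an atom or a box we repeat the
-- argument on the smaller left premise Γ ⇒ e.
module Submission where

open import Defs
open import Data.Product using (Σ; ∃; _×_; _,_)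
open import Data.List using ([]; _∷_; _++_)
open import Data.List.Membership.Propositional using (_∈_)
import Data.List.Membership.Propositional.Properties as ∈
open import Data.List.Relation.Unary.Any using (here; there)
open import Data.List.Relation.Binary.Permutation.Propositional
open import Data.List.Relation.Binary.Permutation.Propositional.Properties
  using (∈-resp-↭; drop-∷; shift; ++⁺ˡ)
open import Data.Empty using (⊥-elim)
open import Data.Unit using (tt)
open import Data.Sum using (_⊎_; inj₁; inj₂)
open import Relation.Binary.PropositionalEquality using (_≡_; refl)

variable
  Γ Δ A B C : Ctx
  a b e f x y θ : Fm

∈⇒↭ : x ∈ A → ∃ λ C → A ↭ (x ∷ C)
∈⇒↭ {x} x∈A with ys , zs , refl ← ∈.∈-∃++ x∈A = ys ++ zs , shift x ys zs

↭⇒∈ : A ↭ (x ∷ C) → x ∈ A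
↭⇒∈ ρ = ∈-resp-↭ (↭-sym ρ) (here refl)

↭-prefix : ∀ Ξ → A ↭ (x ∷ C) → Ξ ++ A ↭ (x ∷ Ξ ++ C)
↭-prefix {x = x} {C = C} Ξ ρ = ↭-trans (++⁺ˡ Ξ ρ) (shift x Ξ C)

↭-split : Γ ↭ (x ∷ A) → Γ ↭ (y ∷ B) →
          (y ≡ x × A ↭ B) ⊎ (∃ λ C → A ↭ (y ∷ C) × B ↭ (x ∷ C))
↭-split {x = x} σ τ with ∈-resp-↭ σ (↭⇒∈ τ)
... | here refl = inj₁ (refl , drop-∷ (↭-trans (↭-sym σ) τ))
... | there y∈A with C , ρ ← ∈⇒↭ y∈A =
  inj₂ (C , ρ , drop-∷ (↭-trans (↭-sym τ) (↭-trans σ (↭-prefix (x ∷ []) ρ))))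

exchange : Γ ↭ Δ → Proof Γ θ → Proof Δ θ
exchange ρ (ax m)       = ax (∈-resp-↭ ρ m)
exchange ρ (⊥L m)       = ⊥L (∈-resp-↭ ρ m)
exchange ρ (L∧ σ d)     = L∧ (↭-trans (↭-sym ρ) σ) d
exchange ρ (R∧ d e)     = R∧ (exchange ρ d) (exchange ρ e)
exchange ρ (L∨ σ d e)   = L∨ (↭-trans (↭-sym ρ) σ) d e
exchange ρ (R∨₀ d)      = R∨₀ (exchange ρ d)
exchange ρ (R∨₁ d)      = R∨₁ (exchange ρ d)
exchange ρ (L⇒ σ d e)   = L⇒ (↭-trans (↭-sym ρ) σ) (exchange ρ d) e
exchange ρ (R⇒ d)       = R⇒ (exchange (prep _ ρ) d)
exchange ρ (M□ σ d)     = M□ (↭-trans (↭-sym ρ) σ) d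

mutual
  L⇒-invʳ : Γ ↭ ((e ⇒ f) ∷ Δ) → Proof Γ θ → Proof (f ∷ Δ) θ
  L⇒-invʳ σ (ax m) with there m′ ← ∈-resp-↭ σ m = ax (there m′)
  L⇒-invʳ σ (⊥L m) with there m′ ← ∈-resp-↭ σ m = ⊥L (there m′)
  L⇒-invʳ σ (L∧ {φ = φ} {ψ} τ d) with ↭-split σ τ
  ... | inj₂ (_ , ρ , ρ′) = L∧ (↭-prefix (_ ∷ []) ρ) (L⇒-invʳ-under (φ ∷ ψ ∷ []) ρ′ d)
  L⇒-invʳ σ (R∧ d e)   = R∧ (L⇒-invʳ σ d) (L⇒-invʳ σ e)
  L⇒-invʳ σ (L∨ {φ = φ} {ψ} τ d e) with ↭-split σ τ
  ... | inj₂ (_ , ρ , ρ′) =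
    L∨ (↭-prefix (_ ∷ []) ρ) (L⇒-invʳ-under (φ ∷ []) ρ′ d) (L⇒-invʳ-under (ψ ∷ []) ρ′ e)
  L⇒-invʳ σ (R∨₀ d)    = R∨₀ (L⇒-invʳ σ d)
  L⇒-invʳ σ (R∨₁ d)    = R∨₁ (L⇒-invʳ σ d)
  L⇒-invʳ σ (L⇒ {ψ = b} τ d₁ d₂) with ↭-split σ τ
  ... | inj₁ (refl , ρ) = exchange (prep b (↭-sym ρ)) d₂
  ... | inj₂ (_ , ρ , ρ′) =
    L⇒ (↭-prefix (_ ∷ []) ρ) (L⇒-invʳ σ d₁) (L⇒-invʳ-under (b ∷ []) ρ′ d₂)
  L⇒-invʳ σ (R⇒ {φ = φ} d) = R⇒ (L⇒-invʳ-under (φ ∷ []) σ d)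
  L⇒-invʳ σ (M□ τ d) with ↭-split σ τ
  ... | inj₂ (_ , ρ , _) = M□ (↭-prefix (_ ∷ []) ρ) d

  L⇒-invʳ-under : ∀ Ξ → A ↭ ((e ⇒ f) ∷ C) → Proof (Ξ ++ A) θ → Proof (Ξ ++ f ∷ C) θ
  L⇒-invʳ-under {f = f} {C = C} Ξ ρ d =
    exchange (↭-sym (shift f Ξ C)) (L⇒-invʳ (↭-prefix Ξ ρ) d)

data AtomOrBox : Fm → Set where
  atom : ∀ p → AtomOrBox (atom p)
  box  : ∀ c → AtomOrBox (□ c)

SensibleStrict : Proof Γ θ → Set
SensibleStrict d = Sensible d × Strict d

data L⇒AtomOrBox : Proof Γ θ → Set where
  L⇒-atomOrBox : (σ : Γ ↭ ((a ⇒ b) ∷ Δ)) (l : Proof Γ a) (r : Proof (b ∷ Δ) θ) →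
                 AtomOrBox a → L⇒AtomOrBox (L⇒ σ l r)

sensibleStrict⊎L⇒AtomOrBox : (d : Proof Γ θ) → SensibleStrict d ⊎ L⇒AtomOrBox d
sensibleStrict⊎L⇒AtomOrBox (L⇒ {φ = atom p} σ l r) = inj₂ (L⇒-atomOrBox σ l r (atom p))
sensibleStrict⊎L⇒AtomOrBox (L⇒ {φ = □ c} σ l r)    = inj₂ (L⇒-atomOrBox σ l r (box c))
sensibleStrict⊎L⇒AtomOrBox (L⇒ {φ = ⊥'} _ _ _)     = inj₁ (tt , tt)
sensibleStrict⊎L⇒AtomOrBox (L⇒ {φ = _ ∧ _} _ _ _)  = inj₁ (tt , tt)
sensibleStrict⊎L⇒AtomOrBox (L⇒ {φ = _ ∨ _} _ _ _)  = inj₁ (tt , tt)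
sensibleStrict⊎L⇒AtomOrBox (L⇒ {φ = _ ⇒ _} _ _ _)  = inj₁ (tt , tt)
sensibleStrict⊎L⇒AtomOrBox (ax _)       = inj₁ (tt , tt)
sensibleStrict⊎L⇒AtomOrBox (⊥L _)       = inj₁ (tt , tt)
sensibleStrict⊎L⇒AtomOrBox (L∧ _ _)     = inj₁ (tt , tt)
sensibleStrict⊎L⇒AtomOrBox (R∧ _ _)     = inj₁ (tt , tt)
sensibleStrict⊎L⇒AtomOrBox (L∨ _ _ _)   = inj₁ (tt , tt)
sensibleStrict⊎L⇒AtomOrBox (R∨₀ _)      = inj₁ (tt , tt)
sensibleStrict⊎L⇒AtomOrBox (R∨₁ _)      = inj₁ (tt , tt)
sensibleStrict⊎L⇒AtomOrBox (R⇒ _)       = inj₁ (tt , tt)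
sensibleStrict⊎L⇒AtomOrBox (M□ _ _)     = inj₁ (tt , tt)

sensibleStrict-from-left-premise :
  Irreducible Γ → AtomOrBox a → Γ ↭ ((a ⇒ b) ∷ Δ) → Proof Γ a → Proof Γ θ →
  Σ (Proof Γ θ) SensibleStrict
sensibleStrict-from-left-premise (irr , _) _ _ (⊥L m)     _ = ⊥-elim (irr m)
sensibleStrict-from-left-premise (irr , _) _ _ (L∧ τ _)   _ = ⊥-elim (irr (↭⇒∈ τ))
sensibleStrict-from-left-premise (irr , _) _ _ (L∨ τ _ _) _ = ⊥-elim (irr (↭⇒∈ τ))
sensibleStrict-from-left-premise {b = b} (_ , irr) (atom p) σ (ax m) _ =
  ⊥-elim (irr p b m (↭⇒∈ σ))
sensibleStrict-from-left-premise _ (box _) σ l@(M□ _ _) d =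
  L⇒ σ l (L⇒-invʳ σ d) , tt , inj₂ tt
sensibleStrict-from-left-premise irr _ _ (L⇒ τ l r) d
  with sensibleStrict⊎L⇒AtomOrBox (L⇒ τ l (L⇒-invʳ τ d))
... | inj₁ good = L⇒ τ l (L⇒-invʳ τ d) , good
... | inj₂ (L⇒-atomOrBox _ _ _ ab) = sensibleStrict-from-left-premise irr ab τ l d

lemma3p2 : ∀ (Γ : Ctx) (φ : Fm) → Irreducible Γ → Derivable Γ φ →
    Σ (Proof Γ φ) (λ d → Sensible d × Strict d)
lemma3p2 Γ φ irr d with sensibleStrict⊎L⇒AtomOrBox d
... | inj₁ good = d , good
... | inj₂ (L⇒-atomOrBox σ l _ ab) = sensibleStrict-from-left-premise irr ab σ l d
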